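{- Let $n\ge 3$, let $\overrightarrow{C_n}$ be an oriented cycle and $D$ a nonempty set of finite distances of $\overrightarrow{C_n}$ with $\min(D)=1$. If $\overrightarrow{C_n}$ is $D$-antimagic, then $\overrightarrow{C_n}$ is either unidirectional or $\Theta$-oriented.
   Context: An oriented cycle is an orientation of the cycle on vertices $v_1,\dots,v_n$. It is unidirectional if (for a suitable labeling) its arcs are $(v_i,v_{i+1})$, $1\le i\le n-1$, and $(v_n,v_1)$; it is $\Theta$-oriented if (for a suitable labeling) its arcs are $(v_i,v_{i+1})$, $1\le i\le n-1$, and $(v_1,v_n)$. $d(u,y)$ is the length of a shortest directed path from $u$ to $y$ ($d(u,u)=0$, $\infty$ if none). $N_D(v)=\{y:d(v,y)\in D\}$; a bijection $f:V\to\{1,\dots,n\}$ is $D$-antimagic if $\omega_D(v)=\sum_{y\in N_D(v)}f(y)$ are pairwise distinct; the graph is $D$-antimagic if such a bijection exists. -}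

module Defs where

open import Data.Nat using (ℕ; zero; suc; _+_; _≡ᵇ_)
open import Data.Bool using (Bool; true; false; _∧_; _∨_; not; if_then_else_)
open import Data.Fin using (Fin; toℕ)
open import Data.Fin.Properties using () renaming (_≟_ to _≟ᶠ_)
open import Data.List using (List; []; _∷_; upTo; allFin; map)
open import Data.Bool.ListAction using (any)
open import Data.Nat.ListAction using (sum)
open import Data.Maybe using (Maybe; just; nothing)
open import Data.Product using (Σ; ∃; _×_; _,_)
open import Function.Definitions using (Bijective; Injective)
open import Relation.Binary.PropositionalEquality using (_≡_)
open import Relation.Nullary.Decidable using (isYes)

-- Indices 0..n-1 stand for v_1..v_n.
-- cycNext n a b : b is the cyclic successor of a (a+1, or 0 if a = n-1).
cycNext : ℕ → ℕ → ℕ → Bool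
cycNext n a b = ((a + 1) ≡ᵇ b) ∨ (((a + 1) ≡ᵇ n) ∧ (b ≡ᵇ 0))

-- An oriented cycle on vertex set Fin n: the underlying cycle has edges
-- {i, i+1 mod n}; the orientation o i says whether the edge {i, i+1 mod n}
-- is the arc (i, i+1 mod n) (true) or the arc (i+1 mod n, i) (false).
Orientation : ℕ → Set
Orientation n = Fin n → Bool

arc : ∀ {n} → Orientation n → Fin n → Fin n → Bool
arc {n} o u v =
  (cycNext n (toℕ u) (toℕ v) ∧ o u) ∨ (cycNext n (toℕ v) (toℕ u) ∧ not (o v))

reach : ∀ {n} → Orientation n → ℕ → Fin n → Fin n → Bool
reach o zero    u y = isYes (u ≟ᶠ y)
reach {n} o (suc k) u y = any (λ z → arc o u z ∧ reach o k z y) (allFin n)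

firstHit : (ℕ → Bool) → List ℕ → Maybe ℕ
firstHit p []       = nothing
firstHit p (k ∷ ks) = if p k then just k else firstHit p ks

-- d(u,y): the least k with a directed walk (equivalently path) of length k
-- from u to y; shortest such walks are paths, of length < n, so searching
-- k ∈ {0,…,n-1} suffices; nothing encodes d(u,y) = ∞.
dist : ∀ {n} → Orientation n → Fin n → Fin n → Maybe ℕ
dist {n} o u y = firstHit (λ k → reach o k u y) (upTo n)

inD : (ℕ → Bool) → Maybe ℕ → Bool
inD D (just k) = D k
inD D nothing  = false

DistanceSet : ∀ {n} → Orientation n → (ℕ → Bool) → Set
DistanceSet {n} o D = ∀ k → D k ≡ true → Σ (Fin n) λ u → Σ (Fin n) λ y → dist o u y ≡ just k

-- ω_D(v) for the labeling y ↦ toℕ (g y) + 1  (g a bijection Fin n → Fin n,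
-- so f = toℕ ∘ g + 1 ranges bijectively over {1,…,n})
weight : ∀ {n} → Orientation n → (ℕ → Bool) → (Fin n → Fin n) → Fin n → ℕ
weight {n} o D g v =
  sum (map (λ y → if inD D (dist o v y) then suc (toℕ (g y)) else 0) (allFin n))

DAntimagic : ∀ {n} → Orientation n → (ℕ → Bool) → Set
DAntimagic {n} o D =
  Σ (Fin n → Fin n) λ g → Bijective _≡_ _≡_ g × Injective _≡_ _≡_ (weight o D g)

uniArc : ℕ → ℕ → ℕ → Bool
uniArc n i j = cycNext n i j

thetaArc : ℕ → ℕ → ℕ → Bool
thetaArc n i j = ((i + 1) ≡ᵇ j) ∨ ((i ≡ᵇ 0) ∧ ((j + 1) ≡ᵇ n))

-- "for a suitable labeling": there is a bijection σ (σ i = v_{i+1}) under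
-- which the arc set is exactly the reference arc set
Unidirectional : ∀ {n} → Orientation n → Set
Unidirectional {n} o = Σ (Fin n → Fin n) λ σ → Bijective _≡_ _≡_ σ ×
  (∀ i j → arc o (σ i) (σ j) ≡ uniArc n (toℕ i) (toℕ j))

ThetaOriented : ∀ {n} → Orientation n → Set
ThetaOriented {n} o = Σ (Fin n → Fin n) λ σ → Bijective _≡_ _≡_ σ ×
  (∀ i j → arc o (σ i) (σ j) ≡ thetaArc n (toℕ i) (toℕ j))

-- Since 0 ∉ D and 1 ∈ D, a sink has weight 0 and a vertex whose only out-neighbour is the sink s
-- has weight f(s); injective weights therefore allow at most one sink and at most one vertex whose
-- only out-neighbour is s. A constant orientation is unidirectional. Otherwise some forward edge is
-- followed by a backward one, which creates a sink s. Walking around the cycle from s, a forward edge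
-- is never followed by a backward one (that would be a second sink), so the edges form a run of
-- backward edges followed by a run of forward edges. If both runs had length at least two, both
-- neighbours of s would have s as their only out-neighbour; so one run is a single edge, and an
-- orientation in which exactly one edge disagrees with all the others is Θ-oriented.

module Submission where

open import Algebra.Definitions using (Identity)
open import Data.Bool using (Bool; true; false; _∧_; _∨_; not; if_then_else_)
open import Data.Bool.Properties
  using (¬-not; ∨-identity; ∨-identityʳ; ∨-comm; ∧-identityʳ; ∧-zeroʳ; not-involutive)
  renaming (_≟_ to _≟ᵇ_)
open import Data.Empty using (⊥-elim)
open import Data.Fin using (Fin; toℕ; fromℕ; fromℕ<; opposite) renaming (zero to fzero; suc to fsuc)
open import Data.Fin.Properties
  using ( all?; ¬∀⟶∃¬; toℕ-injective; toℕ<n; toℕ≤pred[n]; toℕ-fromℕ; toℕ-fromℕ<; fromℕ<-injective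
        ; opposite-prop; opposite-involutive)
  renaming (_≟_ to _≟ᶠ_; suc-injective to fsuc-injective)
open import Data.List using (foldr; map; tabulate; allFin; applyUpTo)
open import Data.List.Properties using (map-tabulate)
open import Data.Maybe using (nothing)
open import Data.Nat using (ℕ; zero; suc; _+_; _*_; _∸_; _≤_; _<_; _≡ᵇ_; z≤n; s≤s; s≤s⁻¹)
open import Data.Nat.DivMod
  using (_%_; _mod_; m%n<n; m%n%n≡m%n; m<n⇒m%n≡m; [m+n]%n≡m%n; [m+kn]%n≡m%n; %-distribˡ-+)
open import Data.Nat.Properties
  using ( +-comm; +-assoc; +-suc; +-identity; *-suc; *-identityˡ; ≤-refl; ≤-trans; n≤1+n; m∸n≤m; +-∸-assoc
        ; m≤n⇒m<n∨m≡n; ≤∧≢⇒<; <⇒≢; 0≢1+n)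
  renaming (_≟_ to _≟ⁿ_)
open import Data.Product using (∃; _×_; _,_; proj₁; proj₂)
open import Data.Sum using (_⊎_; inj₁; inj₂)
open import Function using (id; _∘_)
open import Function.Consequences.Propositional using (strictlySurjective⇒surjective)
open import Function.Construct.Identity using () renaming (bijective to id-bijective)
open import Function.Definitions using (Bijective; Injective)
open import Relation.Binary.PropositionalEquality
open import Relation.Nullary using (Dec; yes; no)
open import Relation.Nullary.Decidable using (isYes; does; isYes≗does; dec-true; dec-false)

open import Defs

module _ {a} {A : Set a} (_∙_ : A → A → A) (ε : A) (identity : Identity _≡_ ε _∙_) where

  foldr-tabulate-ε : ∀ {m} (h : Fin m → A) → (∀ i → h i ≡ ε) → foldr _∙_ ε (tabulate h) ≡ ε
  foldr-tabulate-ε {zero}  h h≡ε = refl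
  foldr-tabulate-ε {suc m} h h≡ε =
    trans (cong₂ _∙_ (h≡ε fzero) (foldr-tabulate-ε (h ∘ fsuc) (h≡ε ∘ fsuc))) (proj₁ identity ε)

  foldr-tabulate-single : ∀ {m} (h : Fin m → A) s → (∀ i → i ≢ s → h i ≡ ε) →
                          foldr _∙_ ε (tabulate h) ≡ h s
  foldr-tabulate-single h fzero h≡ε =
    trans (cong (h fzero ∙_) (foldr-tabulate-ε (h ∘ fsuc) (λ i → h≡ε (fsuc i) λ ())))
          (proj₂ identity (h fzero))
  foldr-tabulate-single h (fsuc s) h≡ε =
    trans (cong (_∙ foldr _∙_ ε (tabulate (h ∘ fsuc))) (h≡ε fzero λ ()))
          (trans (proj₁ identity (foldr _∙_ ε (tabulate (h ∘ fsuc))))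
                 (foldr-tabulate-single (h ∘ fsuc) s (λ i i≢s → h≡ε (fsuc i) (i≢s ∘ fsuc-injective))))

  foldr-map-allFin-ε : ∀ {m} (h : Fin m → A) → (∀ i → h i ≡ ε) → foldr _∙_ ε (map h (allFin m)) ≡ ε
  foldr-map-allFin-ε h h≡ε = trans (cong (foldr _∙_ ε) (map-tabulate id h)) (foldr-tabulate-ε h h≡ε)

  foldr-map-allFin-single : ∀ {m} (h : Fin m → A) s → (∀ i → i ≢ s → h i ≡ ε) →
                            foldr _∙_ ε (map h (allFin m)) ≡ h s
  foldr-map-allFin-single h s h≡ε =
    trans (cong (foldr _∙_ ε) (map-tabulate id h)) (foldr-tabulate-single h s h≡ε)

true≢false : true ≢ false
true≢false ()

does-cong : ∀ {p q} {P : Set p} {Q : Set q} (p? : Dec P) (q? : Dec Q) → (P → Q) → (Q → P) →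
            does p? ≡ does q?
does-cong (yes p) (yes q) P→Q Q→P = refl
does-cong (yes p) (no ¬q) P→Q Q→P = ⊥-elim (¬q (P→Q p))
does-cong (no ¬p) (yes q) P→Q Q→P = ⊥-elim (¬p (Q→P q))
does-cong (no ¬p) (no ¬q) P→Q Q→P = refl

isYes-≟-cong : ∀ {m k} {x y : Fin m} {x′ y′ : Fin k} →
               (x ≡ y → x′ ≡ y′) → (x′ ≡ y′ → x ≡ y) → isYes (x ≟ᶠ y) ≡ isYes (x′ ≟ᶠ y′)
isYes-≟-cong {x = x} {y} {x′} {y′} to from = begin
  isYes (x ≟ᶠ y)    ≡⟨ isYes≗does (x ≟ᶠ y) ⟩
  does (x ≟ᶠ y)     ≡⟨ does-cong (x ≟ᶠ y) (x′ ≟ᶠ y′) to from ⟩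
  does (x′ ≟ᶠ y′)   ≡⟨ isYes≗does (x′ ≟ᶠ y′) ⟨
  isYes (x′ ≟ᶠ y′)  ∎
  where open ≡-Reasoning

isYes-≟-injective : ∀ {m k} {f : Fin m → Fin k} → Injective _≡_ _≡_ f →
                    ∀ x y → isYes (f x ≟ᶠ f y) ≡ isYes (x ≟ᶠ y)
isYes-≟-injective {f = f} f-inj x y = isYes-≟-cong f-inj (cong f)

isYes-≟-refl : ∀ {m} (x : Fin m) → isYes (x ≟ᶠ x) ≡ true
isYes-≟-refl x = trans (isYes≗does (x ≟ᶠ x)) (dec-true (x ≟ᶠ x) refl)

isYes-≟-≢ : ∀ {m} {x y : Fin m} → x ≢ y → isYes (x ≟ᶠ y) ≡ false
isYes-≟-≢ {x = x} {y} x≢y = trans (isYes≗does (x ≟ᶠ y)) (dec-false (x ≟ᶠ y) x≢y)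

isYes-∧-cong : ∀ {p} {P : Set p} (d : Dec P) {b c : Bool} → (P → b ≡ c) → isYes d ∧ b ≡ isYes d ∧ c
isYes-∧-cong (yes p) b≡c = b≡c p
isYes-∧-cong (no _)   b≡c = refl

firstHit-nothing : ∀ (p : ℕ → Bool) (f : ℕ → ℕ) m → (∀ t → p (f t) ≡ false) →
                   firstHit p (applyUpTo f m) ≡ nothing
firstHit-nothing p f zero    never = refl
firstHit-nothing p f (suc m) never rewrite never 0 = firstHit-nothing p (f ∘ suc) m (never ∘ suc)

upward-closed : ∀ (y : ℕ → Bool) L → (∀ t → t < L → y t ≡ true → y (suc t) ≡ true) →
                ∀ {a} b → a ≤ b → b ≤ L → y a ≡ true → y b ≡ true
upward-closed y L step zero    z≤n _    ya = ya
upward-closed y L step (suc b) a≤1+b 1+b≤L ya with m≤n⇒m<n∨m≡n a≤1+b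
... | inj₂ refl      = ya
... | inj₁ (s≤s a≤b) = step b 1+b≤L (upward-closed y L step b a≤b (≤-trans (n≤1+n b) 1+b≤L) ya)

true-to-false-step : ∀ (y : ℕ → Bool) K → y 0 ≡ true → y K ≡ false →
                     ∃ λ t → y t ≡ true × y (suc t) ≡ false
true-to-false-step y zero    y0 yK = ⊥-elim (true≢false (trans (sym y0) yK))
true-to-false-step y (suc K) y0 yK with y K in yK′
... | true  = K , yK′ , yK
... | false = true-to-false-step y K y0 yK′

cycNext-below : ∀ N a b → a + 1 < N → cycNext N a b ≡ (a + 1 ≡ᵇ b)
cycNext-below N a b a+1<N =
  trans (cong (λ x → (a + 1 ≡ᵇ b) ∨ (x ∧ (b ≡ᵇ 0))) (dec-false (a + 1 ≟ⁿ N) (<⇒≢ a+1<N)))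
        (∨-identityʳ (a + 1 ≡ᵇ b))

cycNext-top : ∀ a b → b ≤ a → cycNext (suc a) a b ≡ (b ≡ᵇ 0)
cycNext-top a b b≤a =
  cong₂ (λ x y → x ∨ (y ∧ (b ≡ᵇ 0)))
        (dec-false (a + 1 ≟ⁿ b) (λ eq → <⇒≢ (s≤s b≤a) (sym (trans (+-comm 1 a) eq))))
        (dec-true (a + 1 ≟ⁿ suc a) (+-comm a 1))

module Cycle (n : ℕ) where

  V : Set
  V = Fin (suc n)

  last : V
  last = fromℕ n

  rot : ℕ → V → V
  rot c i = (toℕ i + c) mod suc n

  toℕ-rot : ∀ c i → toℕ (rot c i) ≡ (toℕ i + c) % suc n
  toℕ-rot c i = toℕ-fromℕ< (m%n<n (toℕ i + c) (suc n))

  rot-rot : ∀ a b i → rot a (rot b i) ≡ rot (b + a) i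
  rot-rot a b i = toℕ-injective (begin
    toℕ (rot a (rot b i))               ≡⟨ toℕ-rot a (rot b i) ⟩
    (toℕ (rot b i) + a) % suc n         ≡⟨ cong (λ k → (k + a) % suc n) (toℕ-rot b i) ⟩
    ((toℕ i + b) % suc n + a) % suc n   ≡⟨ %-distribˡ-+ ((toℕ i + b) % suc n) a (suc n) ⟩
    ((toℕ i + b) % suc n % suc n + a % suc n) % suc n
                                        ≡⟨ cong (λ k → (k + a % suc n) % suc n) (m%n%n≡m%n (toℕ i + b) (suc n)) ⟩
    ((toℕ i + b) % suc n + a % suc n) % suc n ≡⟨ %-distribˡ-+ (toℕ i + b) a (suc n) ⟨
    (toℕ i + b + a) % suc n             ≡⟨ cong (_% suc n) (+-assoc (toℕ i) b a) ⟩
    (toℕ i + (b + a)) % suc n           ≡⟨ toℕ-rot (b + a) i ⟨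
    toℕ (rot (b + a) i)                 ∎)
    where open ≡-Reasoning

  rot-multiple : ∀ c i → rot (c * suc n) i ≡ i
  rot-multiple c i = toℕ-injective (begin
    toℕ (rot (c * suc n) i)          ≡⟨ toℕ-rot (c * suc n) i ⟩
    (toℕ i + c * suc n) % suc n      ≡⟨ [m+kn]%n≡m%n (toℕ i) c (suc n) ⟩
    toℕ i % suc n                    ≡⟨ m<n⇒m%n≡m (toℕ<n i) ⟩
    toℕ i                            ∎)
    where open ≡-Reasoning

  rot-zero : ∀ i → rot 0 i ≡ i
  rot-zero = rot-multiple 0

  rot-comm : ∀ a b i → rot a (rot b i) ≡ rot b (rot a i)
  rot-comm a b i = trans (rot-rot a b i) (trans (cong (λ c → rot c i) (+-comm b a)) (sym (rot-rot b a i)))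

  rot-swap : ∀ i j → rot (toℕ j) i ≡ rot (toℕ i) j
  rot-swap i j = toℕ-injective (trans (toℕ-rot (toℕ j) i)
                   (trans (cong (_% suc n) (+-comm (toℕ i) (toℕ j))) (sym (toℕ-rot (toℕ i) j))))

  rot-inverse : ∀ c i → rot (c * n) (rot c i) ≡ i
  rot-inverse c i = trans (rot-rot (c * n) c i) (trans (cong (λ k → rot k i) (sym (*-suc c n))) (rot-multiple c i))

  rot-injective : ∀ c → Injective _≡_ _≡_ (rot c)
  rot-injective c {i} {j} eq = trans (sym (rot-inverse c i)) (trans (cong (rot (c * n)) eq) (rot-inverse c j))

  rot-bijective : ∀ c → Bijective _≡_ _≡_ (rot c)
  rot-bijective c = rot-injective c , strictlySurjective⇒surjective λ j →
    rot (c * n) j , trans (rot-comm c (c * n) j) (rot-inverse c j)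

  rot-offset-injective : ∀ s {a b} → a < suc n → b < suc n → rot a s ≡ rot b s → a ≡ b
  rot-offset-injective s {a} {b} a<N b<N eq =
    fromℕ<-injective a b a<N b<N (rot-injective (toℕ s) (begin
      rot (toℕ s) (fromℕ< a<N)           ≡⟨ rot-swap (fromℕ< a<N) s ⟩
      rot (toℕ (fromℕ< a<N)) s           ≡⟨ cong (λ k → rot k s) (toℕ-fromℕ< a<N) ⟩
      rot a s                            ≡⟨ eq ⟩
      rot b s                            ≡⟨ cong (λ k → rot k s) (toℕ-fromℕ< b<N) ⟨
      rot (toℕ (fromℕ< b<N)) s           ≡⟨ rot-swap s (fromℕ< b<N) ⟩
      rot (toℕ s) (fromℕ< b<N)           ∎))
    where open ≡-Reasoning

  rot-offset-surjective : ∀ s x → ∃ λ t → t < suc n × rot t s ≡ x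
  rot-offset-surjective s x = toℕ d , toℕ<n d , (begin
    rot (toℕ d) s              ≡⟨ rot-swap s d ⟩
    rot (toℕ s) (rot (toℕ s * n) x) ≡⟨ rot-comm (toℕ s) (toℕ s * n) x ⟩
    rot (toℕ s * n) (rot (toℕ s) x) ≡⟨ rot-inverse (toℕ s) x ⟩
    x                          ∎)
    where
    open ≡-Reasoning
    d = rot (toℕ s * n) x

  next : V → V
  next = rot 1

  next-rot : ∀ t i → next (rot t i) ≡ rot (suc t) i
  next-rot t i = trans (rot-rot 1 t i) (cong (λ c → rot c i) (+-comm t 1))

  next-injective : Injective _≡_ _≡_ next
  next-injective = rot-injective 1

  below-or-last : ∀ i → toℕ i < n ⊎ i ≡ last
  below-or-last i with m≤n⇒m<n∨m≡n (toℕ≤pred[n] i)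
  ... | inj₁ i<n = inj₁ i<n
  ... | inj₂ i≡n = inj₂ (toℕ-injective (trans i≡n (sym (toℕ-fromℕ n))))

  +1<suc : ∀ {a} → a < n → a + 1 < suc n
  +1<suc {a} a<n = subst (_< suc n) (+-comm 1 a) (s≤s a<n)

  toℕ-next-below : ∀ i → toℕ i < n → toℕ (next i) ≡ toℕ i + 1
  toℕ-next-below i i<n = trans (toℕ-rot 1 i) (m<n⇒m%n≡m (+1<suc i<n))

  rot-suc-last : ∀ e → rot (suc (toℕ e)) last ≡ e
  rot-suc-last e = toℕ-injective (begin
    toℕ (rot (suc (toℕ e)) last)       ≡⟨ toℕ-rot (suc (toℕ e)) last ⟩
    (toℕ last + suc (toℕ e)) % suc n   ≡⟨ cong (λ k → (k + suc (toℕ e)) % suc n) (toℕ-fromℕ n) ⟩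
    (n + suc (toℕ e)) % suc n          ≡⟨ cong (_% suc n) (trans (+-suc n (toℕ e)) (+-comm (suc n) (toℕ e))) ⟩
    (toℕ e + suc n) % suc n            ≡⟨ [m+n]%n≡m%n (toℕ e) (suc n) ⟩
    toℕ e % suc n                      ≡⟨ m<n⇒m%n≡m (toℕ<n e) ⟩
    toℕ e                              ∎)
    where open ≡-Reasoning

  next-last : next last ≡ fzero
  next-last = rot-suc-last fzero

  cycNext-next : ∀ u v → cycNext (suc n) (toℕ u) (toℕ v) ≡ isYes (v ≟ᶠ next u)
  cycNext-next u v with below-or-last u
  ... | inj₁ u<n = begin
    cycNext (suc n) (toℕ u) (toℕ v) ≡⟨ cycNext-below (suc n) (toℕ u) (toℕ v) (+1<suc u<n) ⟩
    (toℕ u + 1 ≡ᵇ toℕ v)            ≡⟨ does-cong (toℕ u + 1 ≟ⁿ toℕ v) (v ≟ᶠ next u)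
                                         (λ eq → toℕ-injective (trans (sym eq) (sym next-u)))
                                         (λ eq → trans (sym next-u) (cong toℕ (sym eq))) ⟩
    does (v ≟ᶠ next u)              ≡⟨ isYes≗does (v ≟ᶠ next u) ⟨
    isYes (v ≟ᶠ next u)             ∎
    where open ≡-Reasoning
          next-u = toℕ-next-below u u<n
  ... | inj₂ refl = begin
    cycNext (suc n) (toℕ last) (toℕ v) ≡⟨ cong (λ a → cycNext (suc n) a (toℕ v)) (toℕ-fromℕ n) ⟩
    cycNext (suc n) n (toℕ v)          ≡⟨ cycNext-top n (toℕ v) (toℕ≤pred[n] v) ⟩
    (toℕ v ≡ᵇ 0)                       ≡⟨ does-cong (toℕ v ≟ⁿ 0) (v ≟ᶠ next last)
                                            (λ eq → trans (toℕ-injective eq) (sym next-last))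
                                            (λ eq → cong toℕ (trans eq next-last)) ⟩
    does (v ≟ᶠ next last)              ≡⟨ isYes≗does (v ≟ᶠ next last) ⟨
    isYes (v ≟ᶠ next last)             ∎
    where open ≡-Reasoning

  arc-next : ∀ o u v → arc o u v ≡ (isYes (v ≟ᶠ next u) ∧ o u) ∨ (isYes (u ≟ᶠ next v) ∧ not (o v))
  arc-next o u v = cong₂ (λ p q → (p ∧ o u) ∨ (q ∧ not (o v))) (cycNext-next u v) (cycNext-next v u)

  arc-cong : ∀ {o o′ : Orientation (suc n)} → (∀ x → o x ≡ o′ x) → ∀ u v → arc o u v ≡ arc o′ u v
  arc-cong o≗o′ u v =
    cong₂ (λ a b → (cycNext (suc n) (toℕ u) (toℕ v) ∧ a) ∨ (cycNext (suc n) (toℕ v) (toℕ u) ∧ not b))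
          (o≗o′ u) (o≗o′ v)

  module _ {σ : V → V} (σ-injective : Injective _≡_ _≡_ σ) where

    arc-rotated : (∀ i → next (σ i) ≡ σ (next i)) → ∀ o i j → arc o (σ i) (σ j) ≡ arc (o ∘ σ) i j
    arc-rotated σ-next o i j = begin
      arc o (σ i) (σ j)
        ≡⟨ arc-next o (σ i) (σ j) ⟩
      (isYes (σ j ≟ᶠ next (σ i)) ∧ o (σ i)) ∨ (isYes (σ i ≟ᶠ next (σ j)) ∧ not (o (σ j)))
        ≡⟨ cong₂ (λ p q → (p ∧ o (σ i)) ∨ (q ∧ not (o (σ j)))) (adjacent i j) (adjacent j i) ⟩
      (isYes (j ≟ᶠ next i) ∧ o (σ i)) ∨ (isYes (i ≟ᶠ next j) ∧ not (o (σ j)))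
        ≡⟨ arc-next (o ∘ σ) i j ⟨
      arc (o ∘ σ) i j ∎
      where
      open ≡-Reasoning
      adjacent : ∀ i j → isYes (σ j ≟ᶠ next (σ i)) ≡ isYes (j ≟ᶠ next i)
      adjacent i j = trans (cong (λ x → isYes (σ j ≟ᶠ x)) (σ-next i)) (isYes-≟-injective σ-injective j (next i))

    arc-reflected : (∀ i → next (σ (next i)) ≡ σ i) →
                    ∀ o i j → arc o (σ i) (σ j) ≡ arc (λ x → not (o (σ (next x)))) i j
    arc-reflected σ-next o i j = begin
      arc o (σ i) (σ j)
        ≡⟨ arc-next o (σ i) (σ j) ⟩
      (isYes (σ j ≟ᶠ next (σ i)) ∧ o (σ i)) ∨ (isYes (σ i ≟ᶠ next (σ j)) ∧ not (o (σ j)))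
        ≡⟨ cong₂ (λ p q → (p ∧ o (σ i)) ∨ (q ∧ not (o (σ j)))) (adjacent i j) (adjacent j i) ⟩
      (isYes (i ≟ᶠ next j) ∧ o (σ i)) ∨ (isYes (j ≟ᶠ next i) ∧ not (o (σ j)))
        ≡⟨ ∨-comm (isYes (i ≟ᶠ next j) ∧ o (σ i)) (isYes (j ≟ᶠ next i) ∧ not (o (σ j))) ⟩
      (isYes (j ≟ᶠ next i) ∧ not (o (σ j))) ∨ (isYes (i ≟ᶠ next j) ∧ o (σ i))
        ≡⟨ cong₂ _∨_ (isYes-∧-cong (j ≟ᶠ next i) λ { refl → refl })
                     (isYes-∧-cong (i ≟ᶠ next j) λ { refl → sym (not-involutive _) }) ⟩
      (isYes (j ≟ᶠ next i) ∧ not (o (σ (next i)))) ∨ (isYes (i ≟ᶠ next j) ∧ not (not (o (σ (next j)))))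
        ≡⟨ arc-next (λ x → not (o (σ (next x)))) i j ⟨
      arc (λ x → not (o (σ (next x)))) i j ∎
      where
      open ≡-Reasoning
      adjacent : ∀ i j → isYes (σ j ≟ᶠ next (σ i)) ≡ isYes (i ≟ᶠ next j)
      adjacent i j = isYes-≟-cong
        (λ eq → sym (σ-injective (next-injective (trans (σ-next j) eq))))
        (λ { refl → sym (σ-next j) })

  next-opposite-next : ∀ j → next (opposite (next j)) ≡ opposite j
  next-opposite-next j with below-or-last j
  ... | inj₁ j<n = toℕ-injective (begin
    toℕ (next (opposite (next j)))     ≡⟨ toℕ-rot 1 (opposite (next j)) ⟩
    (toℕ (opposite (next j)) + 1) % suc n
                                       ≡⟨ cong (λ k → (k + 1) % suc n) (opposite-prop (next j)) ⟩
    (n ∸ toℕ (next j) + 1) % suc n     ≡⟨ cong (λ k → (n ∸ k + 1) % suc n) (toℕ-next-below j j<n) ⟩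
    (n ∸ (toℕ j + 1) + 1) % suc n      ≡⟨ cong (_% suc n) n∸[j+1]+1≡n∸j ⟩
    (n ∸ toℕ j) % suc n                ≡⟨ m<n⇒m%n≡m (s≤s (m∸n≤m n (toℕ j))) ⟩
    n ∸ toℕ j                          ≡⟨ opposite-prop j ⟨
    toℕ (opposite j)                   ∎)
    where
    open ≡-Reasoning
    n∸[j+1]+1≡n∸j : n ∸ (toℕ j + 1) + 1 ≡ n ∸ toℕ j
    n∸[j+1]+1≡n∸j = begin
      n ∸ (toℕ j + 1) + 1    ≡⟨ +-comm (n ∸ (toℕ j + 1)) 1 ⟩
      1 + (n ∸ (toℕ j + 1))  ≡⟨ +-∸-assoc 1 (subst (_≤ n) (+-comm 1 (toℕ j)) j<n) ⟨
      suc n ∸ (toℕ j + 1)    ≡⟨ cong (suc n ∸_) (+-comm (toℕ j) 1) ⟩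
      n ∸ toℕ j              ∎
  ... | inj₂ refl = begin
    next (opposite (next last))  ≡⟨ cong (next ∘ opposite) next-last ⟩
    next last                    ≡⟨ next-last ⟩
    fzero                        ≡⟨ opposite-involutive fzero ⟨
    opposite last                ∎
    where open ≡-Reasoning

  opposite-injective : Injective _≡_ _≡_ (opposite {suc n})
  opposite-injective {i} {j} eq =
    trans (sym (opposite-involutive i)) (trans (cong opposite eq) (opposite-involutive j))

  reflect : ℕ → V → V
  reflect c = rot c ∘ opposite

  next-reflect-next : ∀ c j → next (reflect c (next j)) ≡ reflect c j
  next-reflect-next c j = trans (rot-comm 1 c (opposite (next j))) (cong (rot c) (next-opposite-next j))

  reflect-injective : ∀ c → Injective _≡_ _≡_ (reflect c)
  reflect-injective c = opposite-injective ∘ rot-injective c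

  reflect-bijective : ∀ c → Bijective _≡_ _≡_ (reflect c)
  reflect-bijective c = reflect-injective c , strictlySurjective⇒surjective λ j →
    opposite (rot (c * n) j) ,
    trans (cong (rot c) (opposite-involutive (rot (c * n) j))) (trans (rot-comm c (c * n) j) (rot-inverse c j))

  uniformExcept : Bool → V → Orientation (suc n)
  uniformExcept b e x = if isYes (x ≟ᶠ e) then not b else b

  uniformExcept-at : ∀ b e → uniformExcept b e e ≡ not b
  uniformExcept-at b e = cong (λ p → if p then not b else b) (isYes-≟-refl e)

  uniformExcept-away : ∀ b {e x} → x ≢ e → uniformExcept b e x ≡ b
  uniformExcept-away b x≢e = cong (λ p → if p then not b else b) (isYes-≟-≢ x≢e)

  uniformExcept-relabel : ∀ {σ : V → V} → Injective _≡_ _≡_ σ → ∀ b {a e} → σ a ≡ e →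
                          ∀ x → uniformExcept b e (σ x) ≡ uniformExcept b a x
  uniformExcept-relabel σ-inj b {a} refl x = cong (λ p → if p then not b else b) (isYes-≟-injective σ-inj x a)

  below⇒≢last : ∀ {i} → toℕ i < n → i ≢ last
  below⇒≢last i<n refl = <⇒≢ i<n (toℕ-fromℕ n)

  arc-forward : ∀ i j → arc (λ _ → true) i j ≡ uniArc (suc n) (toℕ i) (toℕ j)
  arc-forward i j = trans (cong₂ _∨_ (∧-identityʳ _) (∧-zeroʳ _)) (∨-identityʳ _)

  arc-theta : ∀ i j → arc (uniformExcept true last) i j ≡ thetaArc (suc n) (toℕ i) (toℕ j)
  arc-theta i j = cong₂ _∨_ forward-arc backward-arc
    where
    open ≡-Reasoning
    θ = uniformExcept true last
    last+1 : toℕ last + 1 ≡ suc n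
    last+1 = trans (cong (_+ 1) (toℕ-fromℕ n)) (+-comm n 1)

    forward-arc : cycNext (suc n) (toℕ i) (toℕ j) ∧ θ i ≡ (toℕ i + 1 ≡ᵇ toℕ j)
    forward-arc with below-or-last i
    ... | inj₁ i<n = begin
      cycNext (suc n) (toℕ i) (toℕ j) ∧ θ i
        ≡⟨ cong₂ _∧_ (cycNext-below (suc n) (toℕ i) (toℕ j) (+1<suc i<n))
                     (uniformExcept-away true (below⇒≢last i<n)) ⟩
      (toℕ i + 1 ≡ᵇ toℕ j) ∧ true
        ≡⟨ ∧-identityʳ (toℕ i + 1 ≡ᵇ toℕ j) ⟩
      (toℕ i + 1 ≡ᵇ toℕ j) ∎
    ... | inj₂ refl = begin
      cycNext (suc n) (toℕ last) (toℕ j) ∧ θ last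
        ≡⟨ cong (cycNext (suc n) (toℕ last) (toℕ j) ∧_) (uniformExcept-at true last) ⟩
      cycNext (suc n) (toℕ last) (toℕ j) ∧ false
        ≡⟨ ∧-zeroʳ (cycNext (suc n) (toℕ last) (toℕ j)) ⟩
      false
        ≡⟨ dec-false (toℕ last + 1 ≟ⁿ toℕ j) (λ eq → <⇒≢ (toℕ<n j) (trans (sym eq) last+1)) ⟨
      (toℕ last + 1 ≡ᵇ toℕ j) ∎

    backward-arc : cycNext (suc n) (toℕ j) (toℕ i) ∧ not (θ j) ≡ (toℕ i ≡ᵇ 0) ∧ (toℕ j + 1 ≡ᵇ suc n)
    backward-arc with below-or-last j
    ... | inj₁ j<n = begin
      cycNext (suc n) (toℕ j) (toℕ i) ∧ not (θ j)
        ≡⟨ cong (λ b → cycNext (suc n) (toℕ j) (toℕ i) ∧ not b) (uniformExcept-away true (below⇒≢last j<n)) ⟩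
      cycNext (suc n) (toℕ j) (toℕ i) ∧ false
        ≡⟨ ∧-zeroʳ (cycNext (suc n) (toℕ j) (toℕ i)) ⟩
      false
        ≡⟨ ∧-zeroʳ (toℕ i ≡ᵇ 0) ⟨
      (toℕ i ≡ᵇ 0) ∧ false
        ≡⟨ cong ((toℕ i ≡ᵇ 0) ∧_) (dec-false (toℕ j + 1 ≟ⁿ suc n) (<⇒≢ (+1<suc j<n))) ⟨
      (toℕ i ≡ᵇ 0) ∧ (toℕ j + 1 ≡ᵇ suc n) ∎
    ... | inj₂ refl = begin
      cycNext (suc n) (toℕ last) (toℕ i) ∧ not (θ last)
        ≡⟨ cong₂ (λ a b → cycNext (suc n) a (toℕ i) ∧ not b) (toℕ-fromℕ n) (uniformExcept-at true last) ⟩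
      cycNext (suc n) n (toℕ i) ∧ true
        ≡⟨ cong (_∧ true) (cycNext-top n (toℕ i) (toℕ≤pred[n] i)) ⟩
      (toℕ i ≡ᵇ 0) ∧ true
        ≡⟨ cong ((toℕ i ≡ᵇ 0) ∧_) (dec-true (toℕ last + 1 ≟ⁿ suc n) last+1) ⟨
      (toℕ i ≡ᵇ 0) ∧ (toℕ last + 1 ≡ᵇ suc n) ∎

  not-uniformExcept : ∀ b e x → not (uniformExcept b e x) ≡ uniformExcept (not b) e x
  not-uniformExcept b e x with isYes (x ≟ᶠ e)
  ... | true  = refl
  ... | false = refl

  uniform⇒unidirectional : ∀ o b → (∀ x → o x ≡ b) → Unidirectional o
  uniform⇒unidirectional o true o≡true =
    id , id-bijective _≡_ , λ i j → trans (arc-cong o≡true i j) (arc-forward i j)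
  uniform⇒unidirectional o false o≡false = σ , reflect-bijective 0 , λ i j → begin
    arc o (σ i) (σ j)                    ≡⟨ arc-reflected (reflect-injective 0) (next-reflect-next 0) o i j ⟩
    arc (λ x → not (o (σ (next x)))) i j ≡⟨ arc-cong (λ x → cong not (o≡false (σ (next x)))) i j ⟩
    arc (λ _ → true) i j                 ≡⟨ arc-forward i j ⟩
    uniArc (suc n) (toℕ i) (toℕ j)       ∎
    where
    open ≡-Reasoning
    σ = reflect 0

  uniformExcept⇒thetaOriented : ∀ o b e → (∀ x → o x ≡ uniformExcept b e x) → ThetaOriented o
  uniformExcept⇒thetaOriented o true e o≡ = σ , rot-bijective c , λ i j → begin
    arc o (σ i) (σ j)                 ≡⟨ arc-rotated (rot-injective c) (rot-comm 1 c) o i j ⟩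
    arc (o ∘ σ) i j                   ≡⟨ arc-cong o∘σ≡θ i j ⟩
    arc (uniformExcept true last) i j ≡⟨ arc-theta i j ⟩
    thetaArc (suc n) (toℕ i) (toℕ j)  ∎
    where
    open ≡-Reasoning
    c = suc (toℕ e)
    σ = rot c
    o∘σ≡θ : ∀ x → o (σ x) ≡ uniformExcept true last x
    o∘σ≡θ x = trans (o≡ (σ x)) (uniformExcept-relabel (rot-injective c) true (rot-suc-last e) x)
  uniformExcept⇒thetaOriented o false e o≡ = σ , reflect-bijective c , λ i j → begin
    arc o (σ i) (σ j)                    ≡⟨ arc-reflected (reflect-injective c) (next-reflect-next c) o i j ⟩
    arc (λ x → not (o (σ (next x)))) i j ≡⟨ arc-cong reflected≡θ i j ⟩
    arc (uniformExcept true last) i j    ≡⟨ arc-theta i j ⟩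
    thetaArc (suc n) (toℕ i) (toℕ j)     ∎
    where
    open ≡-Reasoning
    c = suc (toℕ e)
    σ = reflect c
    reflected≡θ : ∀ x → not (o (σ (next x))) ≡ uniformExcept true last x
    reflected≡θ x = begin
      not (o (σ (next x)))                     ≡⟨ cong not (o≡ (σ (next x))) ⟩
      not (uniformExcept false e (σ (next x))) ≡⟨ cong not (uniformExcept-relabel {σ ∘ next}
                                                    (next-injective ∘ reflect-injective c) false
                                                    (trans (cong σ next-last) (rot-suc-last e)) x) ⟩
      not (uniformExcept false last x)         ≡⟨ not-uniformExcept false last x ⟩
      uniformExcept true last x                ∎

  orientation-from-offsets : ∀ (o : Orientation (suc n)) s b {e} → e < suc n → o (rot e s) ≡ not b →
                             (∀ t → t < suc n → t ≢ e → o (rot t s) ≡ b) →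
                             ∀ x → o x ≡ uniformExcept b (rot e s) x
  orientation-from-offsets o s b {e} e<N at-e away-from-e x with rot-offset-surjective s x
  ... | t , t<N , refl with t ≟ⁿ e
  ...   | yes refl = trans at-e (sym (uniformExcept-at b (rot t s)))
  ...   | no t≢e   = trans (away-from-e t t<N t≢e)
                           (sym (uniformExcept-away b (t≢e ∘ rot-offset-injective s t<N e<N)))

  Sink : Orientation (suc n) → V → Set
  Sink o v = ∀ z → arc o v z ≡ false

  OnlyOutNeighbour : Orientation (suc n) → V → V → Set
  OnlyOutNeighbour o v s = ∀ z → arc o v z ≡ isYes (z ≟ᶠ s)

  arc-from-next : ∀ o {w a b} → o (next w) ≡ a → o w ≡ b →
                  ∀ z → arc o (next w) z ≡ (isYes (z ≟ᶠ next (next w)) ∧ a) ∨ (isYes (z ≟ᶠ w) ∧ not b)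
  arc-from-next o {w} refl refl z =
    trans (arc-next o (next w) z) (cong ((isYes (z ≟ᶠ next (next w)) ∧ o (next w)) ∨_) backward-arc)
    where
    backward-arc : isYes (next w ≟ᶠ next z) ∧ not (o z) ≡ isYes (z ≟ᶠ w) ∧ not (o w)
    backward-arc = trans (cong (_∧ not (o z)) (isYes-≟-cong (sym ∘ next-injective) (cong next ∘ sym)))
                         (isYes-∧-cong (z ≟ᶠ w) λ { refl → refl })

  sink-after : ∀ o {w} → o w ≡ true → o (next w) ≡ false → Sink o (next w)
  sink-after o {w} ow onw z =
    trans (arc-from-next o onw ow z)
          (cong₂ _∨_ (∧-zeroʳ (isYes (z ≟ᶠ next (next w)))) (∧-zeroʳ (isYes (z ≟ᶠ w))))

  only-out-forward : ∀ o {w u} → next w ≡ u → o w ≡ true → o u ≡ true → OnlyOutNeighbour o u (next u)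
  only-out-forward o {w} refl ow ou z =
    trans (arc-from-next o ou ow z)
          (trans (cong₂ _∨_ (∧-identityʳ (isYes (z ≟ᶠ next (next w)))) (∧-zeroʳ (isYes (z ≟ᶠ w))))
                 (∨-identityʳ (isYes (z ≟ᶠ next (next w)))))

  only-out-backward : ∀ o {w u} → next w ≡ u → o w ≡ false → o u ≡ false → OnlyOutNeighbour o u w
  only-out-backward o {w} refl ow ou z =
    trans (arc-from-next o ou ow z)
          (trans (cong (_∨ (isYes (z ≟ᶠ w) ∧ true)) (∧-zeroʳ (isYes (z ≟ᶠ next (next w)))))
                 (∧-identityʳ (isYes (z ≟ᶠ w))))

  true-to-false-edge : ∀ o {a b} → o a ≡ true → o b ≡ false → ∃ λ w → o w ≡ true × o (next w) ≡ false
  true-to-false-edge o {a} {b} oa ob with rot-offset-surjective a b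
  ... | K , _ , refl with true-to-false-step (λ t → o (rot t a)) K (trans (cong o (rot-zero a)) oa) ob
  ...   | t , ot , ot+1 = rot t a , ot , trans (cong o (next-rot t a)) ot+1

module Weights (n : ℕ) (o : Orientation (suc (suc n)))
               (D : ℕ → Bool) (D0 : D 0 ≡ false) (D1 : D 1 ≡ true) where
  open Cycle (suc n)

  reach-from-sink : ∀ {v} → Sink o v → ∀ t y → reach o (suc t) v y ≡ false
  reach-from-sink v-sink t y =
    foldr-map-allFin-ε _∨_ false ∨-identity (λ z → arc o _ z ∧ reach o t z y)
                       (λ z → cong (_∧ reach o t z y) (v-sink z))

  reach-via-only-out : ∀ {v s} → OnlyOutNeighbour o v s → ∀ t y → reach o (suc t) v y ≡ reach o t s y
  reach-via-only-out {v} {s} out t y = begin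
    reach o (suc t) v y
      ≡⟨ foldr-map-allFin-single _∨_ false ∨-identity (λ z → arc o v z ∧ reach o t z y) s
           (λ z z≢s → cong (_∧ reach o t z y) (trans (out z) (isYes-≟-≢ z≢s))) ⟩
    arc o v s ∧ reach o t s y
      ≡⟨ cong (_∧ reach o t s y) (trans (out s) (isYes-≟-refl s)) ⟩
    reach o t s y
      ∎
    where open ≡-Reasoning

  inD-dist-from-sink : ∀ {v} → Sink o v → ∀ y → inD D (dist o v y) ≡ false
  inD-dist-from-sink {v} v-sink y with v ≟ᶠ y
  ... | yes _ = D0
  ... | no _
    rewrite firstHit-nothing (λ k → reach o k v y) suc (suc n) (λ t → reach-from-sink v-sink t y) = refl

  only-out-≢ : ∀ {v s} → OnlyOutNeighbour o v s → Sink o s → s ≢ v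
  only-out-≢ {v} out v-sink refl = true≢false (trans (sym (trans (out v) (isYes-≟-refl v))) (v-sink v))

  inD-dist-only-out : ∀ {v s} → OnlyOutNeighbour o v s → Sink o s → ∀ y → inD D (dist o v y) ≡ isYes (s ≟ᶠ y)
  inD-dist-only-out {v} {s} out s-sink y with v ≟ᶠ y
  ... | yes refl = trans D0 (sym (isYes-≟-≢ (only-out-≢ out s-sink)))
  ... | no _
    rewrite reach-via-only-out out 0 y
          | firstHit-nothing (λ k → reach o k v y) (suc ∘ suc) n
              (λ t → trans (reach-via-only-out out (suc t) y) (reach-from-sink s-sink t y))
    with isYes (s ≟ᶠ y)
  ...   | true  = D1
  ...   | false = refl

  module _ (g : V → V) where

    weight-sink : ∀ {v} → Sink o v → weight o D g v ≡ 0
    weight-sink v-sink = foldr-map-allFin-ε _+_ 0 +-identity _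
      (λ y → cong (λ b → if b then suc (toℕ (g y)) else 0) (inD-dist-from-sink v-sink y))

    weight-only-out : ∀ {v s} → OnlyOutNeighbour o v s → Sink o s → weight o D g v ≡ suc (toℕ (g s))
    weight-only-out {v} {s} out s-sink = trans
      (foldr-map-allFin-single _+_ 0 +-identity _ s
        (λ y y≢s → cong (λ b → if b then suc (toℕ (g y)) else 0)
                        (trans (inD-dist-only-out out s-sink y) (isYes-≟-≢ (≢-sym y≢s)))))
      (cong (λ b → if b then suc (toℕ (g s)) else 0) (trans (inD-dist-only-out out s-sink s) (isYes-≟-refl s)))

module Antimagic (m : ℕ) (o : Orientation (suc (suc (suc m))))
                 (D : ℕ → Bool) (D0 : D 0 ≡ false) (D1 : D 1 ≡ true)
                 (g : Fin (suc (suc (suc m))) → Fin (suc (suc (suc m))))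
                 (weight-injective : Injective _≡_ _≡_ (weight o D g)) where
  open Cycle (suc (suc m))
  open Weights (suc m) o D D0 D1

  sink-unique : ∀ {a b} → Sink o a → Sink o b → a ≡ b
  sink-unique a-sink b-sink = weight-injective (trans (weight-sink g a-sink) (sym (weight-sink g b-sink)))

  only-out-unique : ∀ {u v s} → OnlyOutNeighbour o u s → OnlyOutNeighbour o v s → Sink o s → u ≡ v
  only-out-unique u-out v-out s-sink =
    weight-injective (trans (weight-only-out g u-out s-sink) (sym (weight-only-out g v-out s-sink)))

  module _ {w} (ow : o w ≡ true) (onw : o (next w) ≡ false) where

    private
      s = next w
      s-sink = sink-after o ow onw

      edge : ℕ → Bool
      edge t = o (rot t s)

      rot-last : rot (suc (suc m)) s ≡ w
      rot-last = begin
        rot (suc (suc m)) (rot 1 w)   ≡⟨ rot-rot (suc (suc m)) 1 w ⟩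
        rot (suc (suc (suc m))) w     ≡⟨ cong (λ k → rot k w) (*-identityˡ (suc (suc (suc m)))) ⟨
        rot (1 * suc (suc (suc m))) w ≡⟨ rot-multiple 1 w ⟩
        w                             ∎
        where open ≡-Reasoning

      rot-penultimate : next (rot (suc m) s) ≡ w
      rot-penultimate = trans (next-rot (suc m) s) rot-last

    edge-upward : ∀ t → t < suc (suc m) → edge t ≡ true → edge (suc t) ≡ true
    edge-upward t t<L et = ¬-not λ et+1 → 0≢1+n (rot-offset-injective s (s≤s z≤n) (s≤s t<L)
      (trans (rot-zero s) (sink-unique s-sink
        (subst (Sink o) (next-rot t s) (sink-after o et (trans (cong o (next-rot t s)) et+1))))))

    theta-if-edge₁-forward : edge 1 ≡ true → ThetaOriented o
    theta-if-edge₁-forward e₁ = uniformExcept⇒thetaOriented o true (rot 0 s)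
      (orientation-from-offsets o s true (s≤s z≤n) (trans (cong o (rot-zero s)) onw) λ
        { zero    _   0≢0 → ⊥-elim (0≢0 refl)
        ; (suc t) t<N _   → upward-closed edge (suc (suc m)) edge-upward (suc t) (s≤s z≤n) (s≤s⁻¹ t<N) e₁ })

    theta-if-penultimate-edge-backward : edge (suc m) ≡ false → ThetaOriented o
    theta-if-penultimate-edge-backward e-pen = uniformExcept⇒thetaOriented o false (rot (suc (suc m)) s)
      (orientation-from-offsets o s false ≤-refl (trans (cong o rot-last) ow) λ t t<N t≢L →
        before-penultimate t (s≤s⁻¹ (≤∧≢⇒< (s≤s⁻¹ t<N) t≢L)))
      where
      before-penultimate : ∀ t → t ≤ suc m → edge t ≡ false
      before-penultimate t t≤pen = ¬-not λ et → true≢false (trans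
        (sym (upward-closed edge (suc (suc m)) edge-upward (suc m) t≤pen (n≤1+n (suc m)) et)) e-pen)

    -- Otherwise next s and w would be two vertices whose only out-neighbour is s.
    edge₁-backward⇒penultimate-edge-backward : edge 1 ≡ false → edge (suc m) ≡ false
    edge₁-backward⇒penultimate-edge-backward e₁ = ¬-not λ e-pen →
      let next-s≡w = only-out-unique (only-out-backward o refl onw e₁)
                                      (only-out-forward o rot-penultimate e-pen ow) s-sink
      in 1≢L (rot-offset-injective s (s≤s (s≤s z≤n)) ≤-refl (trans next-s≡w (sym rot-last)))
      where 1≢L : 1 ≢ suc (suc m)
            1≢L ()

    theta-from-sink : ThetaOriented o
    theta-from-sink with edge 1 in e₁
    ... | true  = theta-if-edge₁-forward e₁
    ... | false = theta-if-penultimate-edge-backward (edge₁-backward⇒penultimate-edge-backward e₁)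

  unidirectional-or-theta : Unidirectional o ⊎ ThetaOriented o
  unidirectional-or-theta with all? (λ x → o x ≟ᵇ true) | all? (λ x → o x ≟ᵇ false)
  ... | yes all-forward | _                = inj₁ (uniform⇒unidirectional o true all-forward)
  ... | no _            | yes all-backward = inj₁ (uniform⇒unidirectional o false all-backward)
  ... | no not-all-forward | no not-all-backward
    with b , ob≢true  ← ¬∀⟶∃¬ _ _ (λ x → o x ≟ᵇ true) not-all-forward
       | a , oa≢false ← ¬∀⟶∃¬ _ _ (λ x → o x ≟ᵇ false) not-all-backward
    with w , ow , onw ← true-to-false-edge o (¬-not oa≢false) (¬-not ob≢true)
    = inj₂ (theta-from-sink ow onw)

mainTheorem10 : (n : ℕ) → 3 ≤ n → (o : Orientation n) → (D : ℕ → Bool) →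
    DistanceSet o D → D 0 ≡ false → D 1 ≡ true →
    DAntimagic o D → Unidirectional o ⊎ ThetaOriented o
mainTheorem10 (suc (suc (suc m))) (s≤s (s≤s (s≤s z≤n))) o D _ D0 D1 (g , _ , weight-injective) =
  Antimagic.unidirectional-or-theta m o D D0 D1 g weight-injective
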